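{- Let $j\in\{1,\ldots,k\}$ and let $S\in\Omega_{j-1}$ be normalized. Then for all $X\in\Omega_j$ we have $X\,e\,S$ if and only if there exists $p\in u_j^{\mathrm{Aut}(U_{j-1})}$ with $\underline{X}=U_{j-1}\cup\{p\}$ and $X|_{U_{j-1}}=S$.
   Context: Let $U$, $R$ be finite sets and $\Gamma$ a finite group acting on $U$ from the right ($u^\gamma$, with $u^{\beta\gamma}=(u^\beta)^\gamma$), and on subsets $W\subseteq U$ elementwise. A partial assignment is a map $X:W\to R$ with $W\subseteq U$; write $\underline{X}=W$, and $X|_Q$ for the restriction to $Q\subseteq\underline{X}$. $\Gamma$ acts on partial assignments by $X^\gamma:W^\gamma\to R$, $X^\gamma(u)=X(u^{\gamma^{ -1}})$. For an object $Y$ acted on by $\Gamma$, $\mathrm{Aut}(Y)=\{\gamma\in\Gamma:Y^\gamma=Y\}$ and $Y^\Lambda=\{Y^\lambda:\lambda\in\Lambda\}$ for $\Lambda\le\Gamma$. Fix distinct $u_1,\ldots,u_k\in U$ and $U_j=\{u_1,\ldots,u_j\}$ ($U_0=\emptyset$). $\Omega_j$ is the set of partial assignments $X$ with $\underline{X}=U_j^\gamma$ for some $\gamma\in\Gamma$; $X\in\Omega_j$ is normalized if $\underline{X}=U_j$. For $X\in\Omega_j$, $S\in\Omega_{j-1}$, $X\,e\,S$ iff there exists $\gamma\in\Gamma$ with $\underline{X}^\gamma=U_j$, $\underline{S}^\gamma=U_{j-1}$, and $X^\gamma|_{U_{j-1}}=S^\gamma$. -}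

module Defs where

open import Level using (Level; _⊔_; 0ℓ)
open import Data.Nat using (ℕ; suc; _<_)
open import Data.Fin using (Fin; toℕ)
open import Data.Maybe using (Maybe; just; nothing)
open import Data.List using (List)
open import Data.List.Relation.Unary.Any using (Any)
open import Data.Product using (Σ; ∃; _×_)
open import Data.Sum using (_⊎_)
open import Relation.Nullary using (¬_)
open import Relation.Binary.PropositionalEquality using (_≡_)
open import Algebra.Bundles using (Group)

-- The finite set U is modelled as Fin n, the finite set R as Fin r.

IsFiniteGroup : ∀ {c ℓ} → Group c ℓ → Set (c ⊔ ℓ)
IsFiniteGroup G = Σ (List Carrier) λ xs → ∀ g → Any (λ h → g ≈ h) xs
  where open Group G

record IsRightAction {c ℓ} (G : Group c ℓ) (n : ℕ)
         (act : Fin n → Group.Carrier G → Fin n) : Set (c ⊔ ℓ) where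
  open Group G
  field
    act-ε    : ∀ u → act u ε ≡ u
    act-∙    : ∀ u β γ → act u (β ∙ γ) ≡ act (act u β) γ
    act-cong : ∀ u {β γ} → β ≈ γ → act u β ≡ act u γ

-- Subsets of U are predicates; partial assignments are maps Fin n → Maybe (Fin r)
-- (domain = the points sent to 'just').
SubsetU : ℕ → Set₁
SubsetU n = Fin n → Set

SameSet : ∀ {n} → SubsetU n → SubsetU n → Set
SameSet A B = ∀ u → (A u → B u) × (B u → A u)

PA : ℕ → ℕ → Set
PA n r = Fin n → Maybe (Fin r)

dom : ∀ {n r} → PA n r → SubsetU n
dom X u = ∃ λ a → X u ≡ just a

-- "X|_Q = S" (with Q ⊆ underline X): Q ⊆ dom X, and the restriction of X to Q
-- agrees with S as a partial map (same domain Q, same values).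
RestrictEq : ∀ {n r} → PA n r → SubsetU n → PA n r → Set
RestrictEq X Q S =
  (∀ u → Q u → dom X u) × (∀ u → (Q u → X u ≡ S u) × (¬ Q u → S u ≡ nothing))

module Setup {c ℓ} (G : Group c ℓ) {n r : ℕ}
             (act : Fin n → Group.Carrier G → Fin n)
             {k : ℕ} (us : Fin k → Fin n) where
  open Group G

  -- W^γ = { w^γ : w ∈ W },  i.e.  u ∈ W^γ  iff  u^{γ⁻¹} ∈ W
  imgSet : SubsetU n → Carrier → SubsetU n
  imgSet W γ u = W (act u (γ ⁻¹))

  paAct : PA n r → Carrier → PA n r
  paAct X γ u = X (act u (γ ⁻¹))

  -- U_j = {u_1, …, u_j}  (u_{i+1} = us i)
  Uset : ℕ → SubsetU n
  Uset j u = ∃ λ (i : Fin k) → (toℕ i < j) × (us i ≡ u)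

  Ω : ℕ → PA n r → Set c
  Ω j X = ∃ λ γ → SameSet (dom X) (imgSet (Uset j) γ)

  Normalized : ℕ → PA n r → Set
  Normalized j X = SameSet (dom X) (Uset j)

  Aut : SubsetU n → Carrier → Set
  Aut W γ = SameSet (imgSet W γ) W

  E : ℕ → PA n r → PA n r → Set c
  E j X S = ∃ λ γ → SameSet (imgSet (dom X) γ) (Uset j)
                  × SameSet (imgSet (dom S) γ) (Uset (Data.Nat.pred j))
                  × RestrictEq (paAct X γ) (Uset (Data.Nat.pred j)) (paAct S γ)

module Submission where

-- Write U = U_{j-1}, u = u_j and U_j = U ∪ {u}.  The whole argument
-- lives at the level of subsets of U taken up to pointwise equivalence (SameSet):
--   * translating by γ and then by γ⁻¹ is the identity, on subsets and on
--     partial assignments alike, and translation commutes with adding a point;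
--   * Aut(W) is closed under inverses;
--   * the defining clauses of "X|_Q = S" are transported by any γ.
-- (⇒) If γ witnesses X e S, then S normalized gives U^γ = (dom S)^γ = U, so
--     λ = γ⁻¹ ∈ Aut(U); pulling dom(X)^γ = U ∪ {u} back by γ⁻¹ gives
--     dom X = U ∪ {u^λ}, and pulling back X^γ|_U = S^γ gives X|_U = S.
-- (⇐) Given λ ∈ Aut(U) with p = u^λ, the element γ = λ⁻¹ witnesses X e S by the
--     same three computations run forwards.

open import Defs
open import Level using (0ℓ) renaming (suc to lsuc)
open import Data.Nat using (ℕ; suc)
open import Data.Nat.Properties using (m<1+n⇒m<n∨m≡n; m<n⇒m<1+n; ≤-refl)
open import Data.Fin using (Fin; toℕ)
open import Data.Fin.Properties using (toℕ-injective)
open import Data.Product using (Σ; ∃; _×_; _,_; proj₁; proj₂)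
open import Data.Sum using (_⊎_; inj₁; inj₂)
open import Function.Definitions using (Injective)
open import Relation.Binary.Bundles using (Setoid)
open import Relation.Binary.PropositionalEquality
  using (_≡_; refl; sym; trans; cong; subst)
open import Algebra.Bundles using (Group)

insert : ∀ {n} → SubsetU n → Fin n → SubsetU n
insert W p u = W u ⊎ u ≡ p

subsetSetoid : ℕ → Setoid (lsuc 0ℓ) 0ℓ
subsetSetoid n = record
  { Carrier       = SubsetU n
  ; _≈_           = SameSet
  ; isEquivalence = record
    { refl  = λ u → (λ x → x) , (λ x → x)
    ; sym   = λ A≈B u → proj₂ (A≈B u) , proj₁ (A≈B u)
    ; trans = λ A≈B B≈C u → (λ x → proj₁ (B≈C u) (proj₁ (A≈B u) x))
                          , (λ x → proj₂ (A≈B u) (proj₂ (B≈C u) x))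
    }
  }

insert-cong : ∀ {n} {A B : SubsetU n} {p q : Fin n} →
              SameSet A B → p ≡ q → SameSet (insert A p) (insert B q)
insert-cong {A = A} {B} {p} A≈B refl u = to , from
  where
  to : insert A p u → insert B p u
  to (inj₁ a) = inj₁ (proj₁ (A≈B u) a)
  to (inj₂ e) = inj₂ e
  from : insert B p u → insert A p u
  from (inj₁ b) = inj₁ (proj₂ (A≈B u) b)
  from (inj₂ e) = inj₂ e

RestrictEq-cong : ∀ {n r} {X X′ S S′ : PA n r} {Q Q′ : SubsetU n} →
                  (∀ u → X u ≡ X′ u) → (∀ u → S u ≡ S′ u) → SameSet Q Q′ →
                  RestrictEq X Q S → RestrictEq X′ Q′ S′
RestrictEq-cong {X = X} {X′} {S} {S′} {Q} {Q′} X≗X′ S≗S′ Q≈Q′ (Q⊆domX , agree) =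
    (λ u q → domX⇒domX′ u (Q⊆domX u (from u q)))
  , (λ u → (λ q → trans (sym (X≗X′ u)) (trans (proj₁ (agree u) (from u q)) (S≗S′ u)))
         , (λ ¬q → trans (sym (S≗S′ u)) (proj₂ (agree u) (λ q → ¬q (proj₁ (Q≈Q′ u) q)))))
  where
  from : ∀ u → Q′ u → Q u
  from u = proj₂ (Q≈Q′ u)
  domX⇒domX′ : ∀ u → dom X u → dom X′ u
  domX⇒domX′ u (a , eq) = a , trans (sym (X≗X′ u)) eq

module Translation {c ℓ} (G : Group c ℓ) {n r : ℕ}
    (act : Fin n → Group.Carrier G → Fin n) (isAction : IsRightAction G n act)
    {k : ℕ} (us : Fin k → Fin n) where
  open Group G using (Carrier; _⁻¹; inverseˡ; inverseʳ)
  open IsRightAction isAction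
  open Setup G {r = r} act us
  open import Relation.Binary.Reasoning.Setoid (subsetSetoid n)

  act-cancelʳ : ∀ γ u → act (act u γ) (γ ⁻¹) ≡ u
  act-cancelʳ γ u =
    trans (sym (act-∙ u γ (γ ⁻¹))) (trans (act-cong u (inverseʳ γ)) (act-ε u))

  act-cancelˡ : ∀ γ u → act (act u (γ ⁻¹)) γ ≡ u
  act-cancelˡ γ u =
    trans (sym (act-∙ u (γ ⁻¹) γ)) (trans (act-cong u (inverseˡ γ)) (act-ε u))

  imgSet-cong : ∀ {A B} γ → SameSet A B → SameSet (imgSet A γ) (imgSet B γ)
  imgSet-cong γ A≈B u = A≈B (act u (γ ⁻¹))

  imgSet-inverse : ∀ W γ → SameSet (imgSet (imgSet W γ) (γ ⁻¹)) W
  imgSet-inverse W γ u = subst W (act-cancelˡ (γ ⁻¹) u)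
                       , subst W (sym (act-cancelˡ (γ ⁻¹) u))

  paAct-inverse : ∀ X γ u → paAct (paAct X γ) (γ ⁻¹) u ≡ X u
  paAct-inverse X γ u = cong X (act-cancelˡ (γ ⁻¹) u)

  imgSet-insert : ∀ W p γ → SameSet (imgSet (insert W p) γ) (insert (imgSet W γ) (act p γ))
  imgSet-insert W p γ u = to , from
    where
    to : insert W p (act u (γ ⁻¹)) → insert (imgSet W γ) (act p γ) u
    to (inj₁ w) = inj₁ w
    to (inj₂ e) = inj₂ (trans (sym (act-cancelˡ γ u)) (cong (λ v → act v γ) e))
    from : insert (imgSet W γ) (act p γ) u → insert W p (act u (γ ⁻¹))
    from (inj₁ w) = inj₁ w
    from (inj₂ e) = inj₂ (trans (cong (λ v → act v (γ ⁻¹)) e) (act-cancelʳ γ p))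

  Aut-inverse : ∀ {W γ} → Aut W γ → Aut W (γ ⁻¹)
  Aut-inverse {W} {γ} autγ = begin
    imgSet W (γ ⁻¹)               ≈⟨ imgSet-cong (γ ⁻¹) autγ ⟨
    imgSet (imgSet W γ) (γ ⁻¹)    ≈⟨ imgSet-inverse W γ ⟩
    W                             ∎

  RestrictEq-translate : ∀ {X Q S} γ →
    RestrictEq X Q S → RestrictEq (paAct X γ) (imgSet Q γ) (paAct S γ)
  RestrictEq-translate γ (Q⊆domX , agree) =
    (λ u → Q⊆domX (act u (γ ⁻¹))) , (λ u → agree (act u (γ ⁻¹)))

  Uset-suc : ∀ i → SameSet (Uset (suc (toℕ i))) (insert (Uset (toℕ i)) (us i))
  Uset-suc i u = to , from
    where
    to : Uset (suc (toℕ i)) u → insert (Uset (toℕ i)) (us i) u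
    to (i′ , i′<1+i , us-i′≡u) with m<1+n⇒m<n∨m≡n i′<1+i
    ... | inj₁ i′<i = inj₁ (i′ , i′<i , us-i′≡u)
    ... | inj₂ i′≡i = inj₂ (trans (sym us-i′≡u) (cong us (toℕ-injective i′≡i)))
    from : insert (Uset (toℕ i)) (us i) u → Uset (suc (toℕ i)) u
    from (inj₁ (i′ , i′<i , us-i′≡u)) = i′ , m<n⇒m<1+n i′<i , us-i′≡u
    from (inj₂ refl)                  = i , ≤-refl , refl

  module Characterisation (i : Fin k) (S : PA n r) (normS : Normalized (toℕ i) S) where
    private
      U  = Uset (toℕ i)
      Uj = Uset (suc (toℕ i))

    OnePointExtension : PA n r → Set _
    OnePointExtension X =
      Σ (Fin n) λ p → (∃ λ λ′ → Aut U λ′ × p ≡ act (us i) λ′)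
        × SameSet (dom X) (insert U p)
        × RestrictEq X U S

    -- A witness γ of X e S lies in Aut(U), because dom S = U.
    witness-in-Aut : ∀ γ → SameSet (imgSet (dom S) γ) U → Aut U γ
    witness-in-Aut γ domS^γ≈U = begin
      imgSet U γ         ≈⟨ imgSet-cong γ normS ⟨
      imgSet (dom S) γ   ≈⟨ domS^γ≈U ⟩
      U                  ∎

    e⇒extension : ∀ X → E (suc (toℕ i)) X S → OnePointExtension X
    e⇒extension X (γ , domX^γ≈Uj , domS^γ≈U , restrict) =
      act (us i) (γ ⁻¹) , (γ ⁻¹ , autγ⁻¹ , refl) , domX≈ , restrictX
      where
      autγ⁻¹ : Aut U (γ ⁻¹)
      autγ⁻¹ = Aut-inverse (witness-in-Aut γ domS^γ≈U)
      domX≈ : SameSet (dom X) (insert U (act (us i) (γ ⁻¹)))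
      domX≈ = begin
        dom X                                          ≈⟨ imgSet-inverse (dom X) γ ⟨
        imgSet (imgSet (dom X) γ) (γ ⁻¹)               ≈⟨ imgSet-cong (γ ⁻¹) domX^γ≈Uj ⟩
        imgSet Uj (γ ⁻¹)                               ≈⟨ imgSet-cong (γ ⁻¹) (Uset-suc i) ⟩
        imgSet (insert U (us i)) (γ ⁻¹)                ≈⟨ imgSet-insert U (us i) (γ ⁻¹) ⟩
        insert (imgSet U (γ ⁻¹)) (act (us i) (γ ⁻¹))   ≈⟨ insert-cong autγ⁻¹ refl ⟩
        insert U (act (us i) (γ ⁻¹))                   ∎
      restrictX : RestrictEq X U S
      restrictX = RestrictEq-cong (paAct-inverse X γ) (paAct-inverse S γ) autγ⁻¹
                    (RestrictEq-translate (γ ⁻¹) restrict)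

    extension⇒e : ∀ X → OnePointExtension X → E (suc (toℕ i)) X S
    extension⇒e X (_ , (λ′ , autλ′ , refl) , domX≈ , restrictX) =
      λ′ ⁻¹ , domX^γ≈Uj , domS^γ≈U , restrict
      where
      autλ′⁻¹ : Aut U (λ′ ⁻¹)
      autλ′⁻¹ = Aut-inverse autλ′
      domX^γ≈Uj : SameSet (imgSet (dom X) (λ′ ⁻¹)) Uj
      domX^γ≈Uj = begin
        imgSet (dom X) (λ′ ⁻¹)                                   ≈⟨ imgSet-cong (λ′ ⁻¹) domX≈ ⟩
        imgSet (insert U (act (us i) λ′)) (λ′ ⁻¹)                ≈⟨ imgSet-insert U _ (λ′ ⁻¹) ⟩
        insert (imgSet U (λ′ ⁻¹)) (act (act (us i) λ′) (λ′ ⁻¹))  ≈⟨ insert-cong autλ′⁻¹ (act-cancelʳ λ′ (us i)) ⟩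
        insert U (us i)                                          ≈⟨ Uset-suc i ⟨
        Uj                                                       ∎
      domS^γ≈U : SameSet (imgSet (dom S) (λ′ ⁻¹)) U
      domS^γ≈U = begin
        imgSet (dom S) (λ′ ⁻¹)   ≈⟨ imgSet-cong (λ′ ⁻¹) normS ⟩
        imgSet U (λ′ ⁻¹)         ≈⟨ autλ′⁻¹ ⟩
        U                        ∎
      restrict : RestrictEq (paAct X (λ′ ⁻¹)) U (paAct S (λ′ ⁻¹))
      restrict = RestrictEq-cong (λ _ → refl) (λ _ → refl) autλ′⁻¹
                   (RestrictEq-translate (λ′ ⁻¹) restrictX)

lemma4p3 : ∀ {c ℓ} (G : Group c ℓ) → IsFiniteGroup G → {n r : ℕ}
    (act : Fin n → Group.Carrier G → Fin n) → IsRightAction G n act →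
    {k : ℕ} (us : Fin k → Fin n) → Injective _≡_ _≡_ us →
    (i : Fin k) → let open Setup G {r = r} act us in
    (S : PA n r) → Ω (toℕ i) S → Normalized (toℕ i) S →
    (X : PA n r) → Ω (suc (toℕ i)) X →
    (E (suc (toℕ i)) X S →
       Σ (Fin n) λ p → (∃ λ λ' → Aut (Uset (toℕ i)) λ' × p ≡ act (us i) λ')
         × SameSet (dom X) (λ u → Uset (toℕ i) u ⊎ u ≡ p)
         × RestrictEq X (Uset (toℕ i)) S)
    × ((Σ (Fin n) λ p → (∃ λ λ' → Aut (Uset (toℕ i)) λ' × p ≡ act (us i) λ')
         × SameSet (dom X) (λ u → Uset (toℕ i) u ⊎ u ≡ p)
         × RestrictEq X (Uset (toℕ i)) S) →
       E (suc (toℕ i)) X S)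
lemma4p3 G _ act isAction us _ i S _ normS X _ =
  e⇒extension X , extension⇒e X
  where open Translation.Characterisation G act isAction us i S normS
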